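{- Let $\vec{P}(x,y)=(x,\ x+y,\ x+y^2,\ x+y+y^2)$, $\vec{v}_3=(0,0,1,1)$ and $\vec{v}_4=(0,0,0,1)$. For every integer $i>1$: $\mathcal{P}_{i,j}=\mathbb{R}^4$ for $1\leqslant j\leqslant i$; $\mathcal{P}_{i,j}={\rm Span}\{\vec{v}_3,\vec{v}_4\}$ for $i+1\leqslant j\leqslant 2i-1$; $\mathcal{P}_{i,2i}={\rm Span}\{\vec{v}_3\}$; and $\mathcal{P}_{i,j}=0$ for $j>2i$.
   Context: For a vector $\vec{v}=(v_1,\dots,v_t)$ and $l\in\mathbb{N}$, $\binom{\vec{v}}{l}=(\binom{v_1}{l},\dots,\binom{v_t}{l})$. Write $\binom{\vec{P}(x,y)}{l}=\sum_{a,b\geqslant 0}\vec{b}_{l,a,b}\binom{x}{a}\binom{y}{b}$ with $\vec{b}_{l,a,b}\in\mathbb{Z}^t$ (unique). For $i,j\in\mathbb{N}_+$, $\mathcal{P}_{i,j}$ is the real span of all $\vec{b}_{l,a,b}$ with $1\leqslant l\leqslant i$ and $a+b\geqslant j$.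
   Formalization: The spaces $\mathcal{P}_{i,j}$ and the spans of $\vec{v}_3$, $\vec{v}_4$ are taken over ℚ as subspaces of ℚ⁴, rather than as real spans in $\mathbb{R}^4$. -}

module Defs where

open import Data.Nat as ℕ using (ℕ; zero; suc; _≤_)
open import Data.Nat.Combinatorics using (_C_)
open import Data.Integer as ℤ using (ℤ; +_)
open import Data.Rational as ℚ using (ℚ; 0ℚ; 1ℚ)
open import Data.Fin using (Fin; zero; suc)
open import Data.List using (List; []; _∷_)
open import Data.List.Relation.Unary.All using (All)
open import Data.Product using (_×_; _,_; ∃)
open import Relation.Binary.PropositionalEquality using (_≡_)

V4 : Set
V4 = Fin 4 → ℚ

_≋_ : V4 → V4 → Set
u ≋ v = ∀ k → u k ≡ v k

zeroV : V4
zeroV _ = 0ℚ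

_+V_ : V4 → V4 → V4
(u +V v) k = u k ℚ.+ v k

_•_ : ℚ → V4 → V4
(c • v) k = c ℚ.* v k

P : Fin 4 → ℕ → ℕ → ℕ
P zero             x y = x
P (suc zero)       x y = x ℕ.+ y
P (suc (suc zero)) x y = x ℕ.+ y ℕ.* y
P (suc (suc (suc zero))) x y = x ℕ.+ y ℕ.+ y ℕ.* y

sumTo : ℕ → (ℕ → ℤ) → ℤ
sumTo zero    f = f 0
sumTo (suc n) f = sumTo n f ℤ.+ f (suc n)

sign : ℕ → ℤ
sign zero    = + 1
sign (suc n) = ℤ.- sign n

-- Newton (binomial-basis) coefficient of a function f : ℕ → ℕ → ℕ at (a,b):
-- the unique c with f(x,y) = Σ_{a,b} c a b · C(x,a) C(y,b), given by
-- c a b = Δ_x^a Δ_y^b f (0,0) = Σ_{r≤a,s≤b} (-1)^{(a-r)+(b-s)} C(a,r) C(b,s) f(r,s).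
newton : (ℕ → ℕ → ℕ) → ℕ → ℕ → ℤ
newton f a b =
  sumTo a (λ r → sumTo b (λ s →
    sign ((a ℕ.∸ r) ℕ.+ (b ℕ.∸ s)) ℤ.* (+ ((a C r) ℕ.* (b C s) ℕ.* f r s))))

-- b⃗_{l,a,b} : coefficient of C(x,a)C(y,b) in C(P⃗(x,y), l)  (as a vector in ℚ⁴)
bvec : ℕ → ℕ → ℕ → V4
bvec l a b k = newton (λ x y → P k x y C l) a b ℚ./ 1

lincomb : List (ℚ × ℕ × ℕ × ℕ) → V4
lincomb []                  = zeroV
lincomb ((c , l , a , b) ∷ ts) = (c • bvec l a b) +V lincomb ts

InP : ℕ → ℕ → V4 → Set
InP i j v = ∃ λ (ts : List (ℚ × ℕ × ℕ × ℕ)) →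
  All (λ { (c , l , a , b) → (1 ≤ l) × (l ≤ i) × (j ≤ a ℕ.+ b) }) ts × (lincomb ts ≋ v)

v3 v4 : V4
v3 zero = 0ℚ
v3 (suc zero) = 0ℚ
v3 (suc (suc _)) = 1ℚ
v4 (suc (suc (suc zero))) = 1ℚ
v4 _ = 0ℚ

InSpan34 : V4 → Set
InSpan34 v = ∃ λ c → ∃ λ d → ((c • v3) +V (d • v4)) ≋ v

InSpan3 : V4 → Set
InSpan3 v = ∃ λ c → (c • v3) ≋ v

{-# OPTIONS --safe #-}
-- The Newton coefficient b⃗_{l,a,b} is Δ_yᵇ Δ_xᵃ C(P⃗(x, y), l) at the origin. Each coordinate of P⃗
-- is x + q(y), and Δ_x C(x + n, l) = C(x + n, l - 1), so b⃗_{l,a,b} vanishes for a > l and is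
-- otherwise Δᵇ C(q(y), l - a) at 0. As m! C(n, m) is the falling factorial n (n - 1) ⋯ (n - m + 1),
-- the Leibniz rule for Δ shows that C(q(y), m) has degree m · deg q with nonzero top difference,
-- and that the falling factorials of y + y² and of y² differ by m y²ᵐ⁻¹ + ⋯ . Hence coordinates 0, 1
-- of b⃗_{l,a,b} vanish for a + b > l, coordinates 2, 3 vanish for a + b > 2l and agree for
-- a + b ≥ 2l, while b⃗_{i,i,0} = (1,1,·,·), b⃗_{i,0,i} = (0,1,·,·), b⃗_{i,0,2i} = (0,0,c,c) and
-- b⃗_{i,0,2i-1} = (0,0,c′,c″) with c ≠ 0 and c′ ≠ c″ (this one needs i > 1) span the claimed spaces.
module Submission where

open import Defs
open import Data.Fin using (Fin; zero; suc)
open import Data.Nat as ℕ using (ℕ; zero; suc; _!; _<_; _≤_; _∸_; s≤s; z≤n)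
import Data.Nat.Properties as ℕ
import Data.Nat.Tactic.RingSolver as ℕ-Solver
open import Data.Nat.Combinatorics using (_C_; nC1≡n; nCk+nC[k+1]≡[n+1]C[k+1]; k>n⇒nCk≡0)
open import Data.Integer as ℤ using (ℤ; +_; _+_; _*_; _-_; -_; 0ℤ; 1ℤ)
import Data.Integer.Properties as ℤ
import Data.Integer.GCD as ℤ
open import Data.Integer.Tactic.RingSolver using (solve-∀)
open import Data.Rational as ℚ using (ℚ; 0ℚ; 1ℚ; ↥_; 1/_)
import Data.Rational.Properties as ℚ
open import Data.Rational.Solver using (module +-*-Solver)
open +-*-Solver using (solve; _:=_; _:+_; _:*_; _:-_; :-_; con)
open import Data.List using ([]; _∷_; _++_; map)
open import Data.List.Relation.Unary.All using (All; []; _∷_)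
import Data.List.Relation.Unary.All.Properties as All
open import Data.Product using (_×_; _,_; map₁)
open import Data.Sum using (inj₁; inj₂)
open import Function.Bundles using (_⇔_; mk⇔)
open import Relation.Binary.PropositionalEquality
open import Relation.Nullary using (yes; no)

-- Finite differences

Δ : (ℕ → ℤ) → ℕ → ℤ
Δ f y = f (suc y) - f y

Δ^ : ℕ → (ℕ → ℤ) → ℕ → ℤ
Δ^ zero    f = f
Δ^ (suc d) f = Δ^ d (Δ f)

Δ^-cong : ∀ d {f g} → (∀ y → f y ≡ g y) → ∀ y → Δ^ d f y ≡ Δ^ d g y
Δ^-cong zero    f≗g = f≗g
Δ^-cong (suc d) f≗g = Δ^-cong d λ y → cong₂ _-_ (f≗g (suc y)) (f≗g y)

Δ^-additive : (_⊕_ : ℤ → ℤ → ℤ) → (∀ a b c e → (a ⊕ b) - (c ⊕ e) ≡ (a - c) ⊕ (b - e)) →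
              ∀ d f g y → Δ^ d (λ y → f y ⊕ g y) y ≡ Δ^ d f y ⊕ Δ^ d g y
Δ^-additive _⊕_ additive zero    f g y = refl
Δ^-additive _⊕_ additive (suc d) f g y = trans
  (Δ^-cong d (λ z → additive (f (suc z)) (g (suc z)) (f z) (g z)) y)
  (Δ^-additive _⊕_ additive d (Δ f) (Δ g) y)

Δ^-+ : ∀ d f g y → Δ^ d (λ y → f y + g y) y ≡ Δ^ d f y + Δ^ d g y
Δ^-+ = Δ^-additive _+_ solve-∀

Δ^-- : ∀ d f g y → Δ^ d (λ y → f y - g y) y ≡ Δ^ d f y - Δ^ d g y
Δ^-- = Δ^-additive _-_ solve-∀

Δ^-*ˡ : ∀ d c f y → Δ^ d (λ y → c * f y) y ≡ c * Δ^ d f y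
Δ^-*ˡ zero    c f y = refl
Δ^-*ˡ (suc d) c f y = trans (Δ^-cong d (λ z → *-distribˡ-- c (f (suc z)) (f z)) y) (Δ^-*ˡ d c (Δ f) y)
  where
  *-distribˡ-- : ∀ c b e → c * b - c * e ≡ c * (b - e)
  *-distribˡ-- = solve-∀

Δ^-suc : ∀ d f y → Δ^ (suc d) f y ≡ Δ (Δ^ d f) y
Δ^-suc zero    f y = refl
Δ^-suc (suc d) f y = Δ^-suc d (Δ f) y

Δ^-compose : ∀ d e f → Δ^ (d ℕ.+ e) f ≡ Δ^ e (Δ^ d f)
Δ^-compose zero    e f = refl
Δ^-compose (suc d) e f = Δ^-compose d e (Δ f)

Δ^-const : ∀ d c y → Δ^ (suc d) (λ _ → c) y ≡ 0ℤ
Δ^-const zero    c y = ℤ.+-inverseʳ c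
Δ^-const (suc d) c y = trans (Δ^-cong (suc d) (λ _ → ℤ.+-inverseʳ c) y) (Δ^-const d 0ℤ y)

Δ^-zero : ∀ d y → Δ^ d (λ _ → 0ℤ) y ≡ 0ℤ
Δ^-zero zero    y = refl
Δ^-zero (suc d) y = Δ^-const d 0ℤ y

Δ^-shift : ∀ d f y → Δ^ d (λ y → f (suc y)) y ≡ Δ^ d f (suc y)
Δ^-shift zero    f y = refl
Δ^-shift (suc d) f y = Δ^-shift d (Δ f) y

Δ^-comm : ∀ a b (F : ℕ → ℕ → ℤ) x y → Δ^ a (λ r → Δ^ b (F r) y) x ≡ Δ^ b (λ s → Δ^ a (λ r → F r s) x) y
Δ^-comm zero    b F x y = refl
Δ^-comm (suc a) b F x y = trans
  (Δ^-cong a (λ r → sym (Δ^-- b (F (suc r)) (F r) y)) x)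
  (Δ^-comm a b (λ r s → F (suc r) s - F r s) x y)

-- Binomial coefficients and falling factorials

pascalℤ : ∀ n k → + (suc n C suc k) ≡ + (n C k) + + (n C suc k)
pascalℤ n k = trans (cong +_ (sym (nCk+nC[k+1]≡[n+1]C[k+1] n k))) (ℤ.pos-+ (n C k) (n C suc k))

Δ-C : ∀ n l x → Δ (λ x → + ((x ℕ.+ n) C suc l)) x ≡ + ((x ℕ.+ n) C l)
Δ-C n l x = begin
  + (suc N C suc l) - + (N C suc l)              ≡⟨ cong (_- + (N C suc l)) (pascalℤ N l) ⟩
  + (N C l) + + (N C suc l) - + (N C suc l)      ≡⟨ x+y-y≡x (+ (N C l)) (+ (N C suc l)) ⟩
  + (N C l)                                      ∎
  where
  open ≡-Reasoning
  N = x ℕ.+ n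
  x+y-y≡x : ∀ x y → x + y - y ≡ x
  x+y-y≡x = solve-∀

Δ^-C : ∀ a m n → Δ^ a (λ x → + ((x ℕ.+ n) C (a ℕ.+ m))) 0 ≡ + (n C m)
Δ^-C zero    m n = refl
Δ^-C (suc a) m n = trans (Δ^-cong a (Δ-C n (a ℕ.+ m)) 0) (Δ^-C a m n)

Δ^-C-vanish : ∀ {l a} n → l < a → Δ^ a (λ x → + ((x ℕ.+ n) C l)) 0 ≡ 0ℤ
Δ^-C-vanish {zero}  {suc a} n _         = Δ^-const a 1ℤ 0
Δ^-C-vanish {suc l} {suc a} n (s≤s l<a) = trans (Δ^-cong a (Δ-C n l) 0) (Δ^-C-vanish n l<a)

-- Falling factorial n (n - 1) ⋯ (n - m + 1), computed in ℤ so that no factor is truncated.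
ff : ℕ → ℕ → ℤ
ff zero    n = 1ℤ
ff (suc m) n = ff m n * (+ n - + m)

[1+k]*nC[1+k]≡[n-k]*nCk : ∀ n k → + suc k * + (n C suc k) ≡ (+ n - + k) * + (n C k)
[1+k]*nC[1+k]≡[n-k]*nCk zero    zero    = refl
[1+k]*nC[1+k]≡[n-k]*nCk zero    (suc k) = trans (ℤ.*-zeroʳ (+ suc (suc k))) (sym (ℤ.*-zeroʳ (- + suc k)))
[1+k]*nC[1+k]≡[n-k]*nCk (suc n) zero    = trans (ℤ.*-identityˡ _) (trans (cong +_ (nC1≡n (suc n))) (x≡[x-0]*1 (+ suc n)))
  where
  x≡[x-0]*1 : ∀ x → x ≡ (x - 0ℤ) * 1ℤ
  x≡[x-0]*1 = solve-∀
[1+k]*nC[1+k]≡[n-k]*nCk (suc n) (suc k) = begin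
  + suc (suc k) * + (suc n C suc (suc k))    ≡⟨ cong (+ suc (suc k) *_) (pascalℤ n (suc k)) ⟩
  + suc (suc k) * (X + Z)                    ≡⟨ ℤ.*-distribˡ-+ (+ suc (suc k)) X Z ⟩
  + suc (suc k) * X + + suc (suc k) * Z      ≡⟨ cong (λ z → + suc (suc k) * X + z) ([1+k]*nC[1+k]≡[n-k]*nCk n (suc k)) ⟩
  + suc (suc k) * X + (+ n - + suc k) * X    ≡⟨ shift (+ n) (+ k) X ⟩
  + suc k * X + (+ n - + k) * X              ≡⟨ cong (_+ (+ n - + k) * X) ([1+k]*nC[1+k]≡[n-k]*nCk n k) ⟩
  (+ n - + k) * Y + (+ n - + k) * X          ≡⟨ factor (+ n) (+ k) Y X ⟩
  (+ suc n - + suc k) * (Y + X)              ≡⟨ cong ((+ suc n - + suc k) *_) (pascalℤ n k) ⟨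
  (+ suc n - + suc k) * + (suc n C suc k)    ∎
  where
  open ≡-Reasoning
  X = + (n C suc k)
  Y = + (n C k)
  Z = + (n C suc (suc k))
  shift : ∀ n k X → (1ℤ + (1ℤ + k)) * X + (n - (1ℤ + k)) * X ≡ (1ℤ + k) * X + (n - k) * X
  shift = solve-∀
  factor : ∀ n k Y X → (n - k) * Y + (n - k) * X ≡ ((1ℤ + n) - (1ℤ + k)) * (Y + X)
  factor = solve-∀

ff≡m!*nCm : ∀ m n → ff m n ≡ + (m !) * + (n C m)
ff≡m!*nCm zero    n = refl
ff≡m!*nCm (suc m) n = begin
  ff m n * (+ n - + m)                     ≡⟨ cong (_* (+ n - + m)) (ff≡m!*nCm m n) ⟩
  + (m !) * + (n C m) * (+ n - + m)        ≡⟨ x*y*z≡x*[z*y] (+ (m !)) (+ (n C m)) (+ n - + m) ⟩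
  + (m !) * ((+ n - + m) * + (n C m))      ≡⟨ cong (+ (m !) *_) ([1+k]*nC[1+k]≡[n-k]*nCk n m) ⟨
  + (m !) * (+ suc m * + (n C suc m))      ≡⟨ x*[y*z]≡y*x*z (+ (m !)) (+ suc m) (+ (n C suc m)) ⟩
  + suc m * + (m !) * + (n C suc m)        ≡⟨ cong (_* + (n C suc m)) (ℤ.pos-* (suc m) (m !)) ⟨
  + (suc m !) * + (n C suc m)              ∎
  where
  open ≡-Reasoning
  x*y*z≡x*[z*y] : ∀ x y z → x * y * z ≡ x * (z * y)
  x*y*z≡x*[z*y] = solve-∀
  x*[y*z]≡y*x*z : ∀ x y z → x * (y * z) ≡ y * x * z
  x*[y*z]≡y*x*z = solve-∀

+[n!]≢0 : ∀ n → + (n !) ≢ 0ℤ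
+[n!]≢0 n n!≡0 = ℕ.≢-nonZero⁻¹ (n !) {{n ℕ.!≢0}} (ℤ.+-injective n!≡0)

+[m!]*-cancel : ∀ m {x y} → + (m !) * x ≡ + (m !) * y → x ≡ y
+[m!]*-cancel m {x} {y} = ℤ.*-cancelˡ-≡ (+ (m !)) x y {{m ℕ.!≢0}}

Δ^-ff∘ : ∀ m (q : ℕ → ℕ) b y → Δ^ b (λ y → ff m (q y)) y ≡ + (m !) * Δ^ b (λ y → + (q y C m)) y
Δ^-ff∘ m q b y = trans (Δ^-cong b (λ y → ff≡m!*nCm m (q y)) y) (Δ^-*ˡ b (+ (m !)) (λ y → + (q y C m)) y)

-- Newton coefficients as iterated differences

sumTo-cong : ∀ n {f g : ℕ → ℤ} → (∀ r → f r ≡ g r) → sumTo n f ≡ sumTo n g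
sumTo-cong zero    f≗g = f≗g 0
sumTo-cong (suc n) f≗g = cong₂ _+_ (sumTo-cong n f≗g) (f≗g (suc n))

sumTo-*ˡ : ∀ n c f → sumTo n (λ r → c * f r) ≡ c * sumTo n f
sumTo-*ˡ zero    c f = refl
sumTo-*ˡ (suc n) c f =
  trans (cong (_+ c * f (suc n)) (sumTo-*ˡ n c f)) (sym (ℤ.*-distribˡ-+ c (sumTo n f) (f (suc n))))

sumTo-- : ∀ n f g → sumTo n (λ r → f r - g r) ≡ sumTo n f - sumTo n g
sumTo-- zero    f g = refl
sumTo-- (suc n) f g =
  trans (cong (_+ (f (suc n) - g (suc n))) (sumTo-- n f g)) (interchange (sumTo n f) (sumTo n g) (f (suc n)) (g (suc n)))
  where
  interchange : ∀ a b c d → (a - b) + (c - d) ≡ (a + c) - (b + d)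
  interchange = solve-∀

sumTo-peel : ∀ n f → sumTo (suc n) f ≡ f 0 + sumTo n (λ r → f (suc r))
sumTo-peel zero    f = refl
sumTo-peel (suc n) f =
  trans (cong (_+ f (suc (suc n))) (sumTo-peel n f)) (ℤ.+-assoc (f 0) (sumTo n (λ r → f (suc r))) (f (suc (suc n))))

sign-+ : ∀ m n → sign (m ℕ.+ n) ≡ sign m * sign n
sign-+ zero    n = sym (ℤ.*-identityˡ (sign n))
sign-+ (suc m) n = trans (cong -_ (sign-+ m n)) (ℤ.neg-distribˡ-* (sign m) (sign n))

sign-∸-suc : ∀ {n r} → r < n → sign (n ∸ r) ≡ - sign (n ∸ suc r)
sign-∸-suc {suc n} {zero}  _         = refl
sign-∸-suc {suc n} {suc r} (s≤s r<n) = sign-∸-suc r<n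

-- (-1)ⁿ⁻ʳ C(n, r); for r > n the junk value of n ∸ r is harmless since C(n, r) = 0.
signedC : ℕ → ℕ → ℤ
signedC n r = sign (n ∸ r) * + (n C r)

signedC-zero : ∀ n → signedC (suc n) 0 ≡ - signedC n 0
signedC-zero n = sym (ℤ.neg-distribˡ-* (sign n) 1ℤ)

signedC-suc : ∀ n r → signedC (suc n) (suc r) ≡ signedC n r - signedC n (suc r)
signedC-suc n r = begin
  sign (n ∸ r) * + (suc n C suc r)                           ≡⟨ cong (sign (n ∸ r) *_) (pascalℤ n r) ⟩
  sign (n ∸ r) * (+ (n C r) + + (n C suc r))                 ≡⟨ ℤ.*-distribˡ-+ (sign (n ∸ r)) _ _ ⟩
  signedC n r + sign (n ∸ r) * + (n C suc r)                 ≡⟨ cong (_+_ (signedC n r)) flip ⟩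
  signedC n r - signedC n (suc r)                            ∎
  where
  open ≡-Reasoning
  flip : sign (n ∸ r) * + (n C suc r) ≡ - signedC n (suc r)
  flip with r ℕ.<? n
  ... | yes r<n = trans (cong (_* + (n C suc r)) (sign-∸-suc r<n)) (sym (ℤ.neg-distribˡ-* (sign (n ∸ suc r)) _))
  ... | no  r≮n rewrite k>n⇒nCk≡0 (s≤s (ℕ.≮⇒≥ r≮n)) =
        trans (ℤ.*-zeroʳ (sign (n ∸ r))) (cong -_ (sym (ℤ.*-zeroʳ (sign (n ∸ suc r)))))

signedC-top : ∀ n → signedC n (suc n) ≡ 0ℤ
signedC-top n rewrite k>n⇒nCk≡0 (ℕ.n<1+n n) = ℤ.*-zeroʳ (sign (n ∸ suc n))

Σ-signedC-suc : ∀ n g → sumTo (suc n) (λ r → signedC (suc n) r * g r) ≡ sumTo n (λ r → signedC n r * Δ g r)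
Σ-signedC-suc n g = begin
  sumTo (suc n) (λ r → signedC (suc n) r * g r)                     ≡⟨ sumTo-peel n _ ⟩
  signedC (suc n) 0 * g 0 + sumTo n (λ r → signedC (suc n) (suc r) * g (suc r))
    ≡⟨ cong₂ _+_ (cong (_* g 0) (signedC-zero n)) (sumTo-cong n (λ r → cong (_* g (suc r)) (signedC-suc n r))) ⟩
  (- signedC n 0) * g 0 + sumTo n (λ r → (signedC n r - signedC n (suc r)) * g (suc r))
    ≡⟨ cong (_+_ ((- signedC n 0) * g 0))
            (trans (sumTo-cong n (λ r → [x-y]*z≡x*z-y*z (signedC n r) (signedC n (suc r)) (g (suc r)))) (sumTo-- n _ _)) ⟩
  (- signedC n 0) * g 0 + (A - B)                                   ≡⟨ rearrange A (signedC n 0) (g 0) B ⟩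
  A - (signedC n 0 * g 0 + B)                                       ≡⟨ cong (_-_ A) S≡w₀g₀+B ⟨
  A - S                                                             ≡⟨ sumTo-- n _ _ ⟨
  sumTo n (λ r → signedC n r * g (suc r) - signedC n r * g r)
    ≡⟨ sumTo-cong n (λ r → x*[y-z]≡x*y-x*z (signedC n r) (g (suc r)) (g r)) ⟨
  sumTo n (λ r → signedC n r * Δ g r)                               ∎
  where
  open ≡-Reasoning
  A = sumTo n (λ r → signedC n r * g (suc r))
  B = sumTo n (λ r → signedC n (suc r) * g (suc r))
  S = sumTo n (λ r → signedC n r * g r)
  S≡w₀g₀+B : S ≡ signedC n 0 * g 0 + B
  S≡w₀g₀+B = begin
    S                                              ≡⟨ ℤ.+-identityʳ S ⟨
    S + 0ℤ                                         ≡⟨ cong (_+_ S) (trans (cong (_* g (suc n)) (signedC-top n)) (ℤ.*-zeroˡ (g (suc n)))) ⟨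
    sumTo (suc n) (λ r → signedC n r * g r)        ≡⟨ sumTo-peel n _ ⟩
    signedC n 0 * g 0 + B                          ∎
  x*[y-z]≡x*y-x*z : ∀ x y z → x * (y - z) ≡ x * y - x * z
  x*[y-z]≡x*y-x*z = solve-∀
  [x-y]*z≡x*z-y*z : ∀ x y z → (x - y) * z ≡ x * z - y * z
  [x-y]*z≡x*z-y*z = solve-∀
  rearrange : ∀ a w g b → (- w) * g + (a - b) ≡ a - (w * g + b)
  rearrange = solve-∀

Δ^≡Σ : ∀ n g → Δ^ n g 0 ≡ sumTo n (λ r → signedC n r * g r)
Δ^≡Σ zero    g = sym (ℤ.*-identityˡ (g 0))
Δ^≡Σ (suc n) g = trans (Δ^≡Σ n (Δ g)) (sym (Σ-signedC-suc n g))

newton≡Δ^Δ^ : ∀ f a b → newton f a b ≡ Δ^ b (λ y → Δ^ a (λ x → + f x y) 0) 0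
newton≡Δ^Δ^ f a b = begin
  newton f a b
    ≡⟨ sumTo-cong a (λ r → trans (sumTo-cong b (term r)) (sumTo-*ˡ b (signedC a r) _)) ⟩
  sumTo a (λ r → signedC a r * sumTo b (λ s → signedC b s * + f r s))
    ≡⟨ sumTo-cong a (λ r → cong (signedC a r *_) (Δ^≡Σ b (λ s → + f r s))) ⟨
  sumTo a (λ r → signedC a r * Δ^ b (λ s → + f r s) 0)
    ≡⟨ Δ^≡Σ a (λ r → Δ^ b (λ s → + f r s) 0) ⟨
  Δ^ a (λ x → Δ^ b (λ y → + f x y) 0) 0
    ≡⟨ Δ^-comm a b (λ x y → + f x y) 0 0 ⟩
  Δ^ b (λ y → Δ^ a (λ x → + f x y) 0) 0 ∎
  where
  open ≡-Reasoning
  regroup : ∀ σ τ c d v → σ * τ * (c * d * v) ≡ σ * c * (τ * d * v)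
  regroup = solve-∀
  term : ∀ r s → sign ((a ∸ r) ℕ.+ (b ∸ s)) * + ((a C r) ℕ.* (b C s) ℕ.* f r s)
               ≡ signedC a r * (signedC b s * + f r s)
  term r s = begin
    sign ((a ∸ r) ℕ.+ (b ∸ s)) * + ((a C r) ℕ.* (b C s) ℕ.* f r s)
      ≡⟨ cong₂ _*_ (sign-+ (a ∸ r) (b ∸ s))
                   (trans (ℤ.pos-* ((a C r) ℕ.* (b C s)) (f r s)) (cong (_* + f r s) (ℤ.pos-* (a C r) (b C s)))) ⟩
    sign (a ∸ r) * sign (b ∸ s) * (+ (a C r) * + (b C s) * + f r s)
      ≡⟨ regroup (sign (a ∸ r)) (sign (b ∸ s)) (+ (a C r)) (+ (b C s)) (+ f r s) ⟩
    signedC a r * (signedC b s * + f r s) ∎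

-- Leading terms

-- f y = α yᵈ + O(yᵈ⁻¹), in the form that finite differences detect.
record HasLead (d : ℕ) (α : ℤ) (f : ℕ → ℤ) : Set where
  constructor hasLead
  field Δ^≡ : ∀ y → Δ^ d f y ≡ + (d !) * α
open HasLead

HasLead-cong : ∀ {d α f g} → (∀ y → f y ≡ g y) → HasLead d α f → HasLead d α g
HasLead-cong {d} f≗g hf = hasLead λ y → trans (sym (Δ^-cong d f≗g y)) (Δ^≡ hf y)

HasLead-resp : ∀ {d d′ α β f} → d ≡ d′ → α ≡ β → HasLead d α f → HasLead d′ β f
HasLead-resp refl refl hf = hf

HasLead-scale : ∀ {d α f} c → HasLead d α f → HasLead d (c * α) (λ y → c * f y)
HasLead-scale {d} {α} {f} c hf = hasLead λ y → begin
  Δ^ d (λ y → c * f y) y ≡⟨ Δ^-*ˡ d c f y ⟩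
  c * Δ^ d f y           ≡⟨ cong (c *_) (Δ^≡ hf y) ⟩
  c * (+ (d !) * α)      ≡⟨ x*[y*z]≡y*[x*z] c (+ (d !)) α ⟩
  + (d !) * (c * α)      ∎
  where
  open ≡-Reasoning
  x*[y*z]≡y*[x*z] : ∀ x y z → x * (y * z) ≡ y * (x * z)
  x*[y*z]≡y*[x*z] = solve-∀

HasLead-+ : ∀ {d α β f g} → HasLead d α f → HasLead d β g → HasLead d (α + β) (λ y → f y + g y)
HasLead-+ {d} {α} {β} {f} {g} hf hg = hasLead λ y → begin
  Δ^ d (λ y → f y + g y) y         ≡⟨ Δ^-+ d f g y ⟩
  Δ^ d f y + Δ^ d g y              ≡⟨ cong₂ _+_ (Δ^≡ hf y) (Δ^≡ hg y) ⟩
  + (d !) * α + + (d !) * β        ≡⟨ ℤ.*-distribˡ-+ (+ (d !)) α β ⟨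
  + (d !) * (α + β)                ∎
  where open ≡-Reasoning

HasLead-shift : ∀ {d α f} → HasLead d α f → HasLead d α (λ y → f (suc y))
HasLead-shift {d} {f = f} hf = hasLead λ y → trans (Δ^-shift d f y) (Δ^≡ hf (suc y))

[1+d]!*α≡d!*[[1+d]*α] : ∀ d α → + (suc d !) * α ≡ + (d !) * (+ suc d * α)
[1+d]!*α≡d!*[[1+d]*α] d α = begin
  + (suc d ℕ.* d !) * α     ≡⟨ cong (_* α) (ℤ.pos-* (suc d) (d !)) ⟩
  + suc d * + (d !) * α     ≡⟨ x*y*z≡y*[x*z] (+ suc d) (+ (d !)) α ⟩
  + (d !) * (+ suc d * α)   ∎
  where
  open ≡-Reasoning
  x*y*z≡y*[x*z] : ∀ x y z → x * y * z ≡ y * (x * z)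
  x*y*z≡y*[x*z] = solve-∀

HasLead-Δ : ∀ {d α f} → HasLead (suc d) α f → HasLead d (+ suc d * α) (Δ f)
HasLead-Δ {d} {α} hf = hasLead λ y → trans (Δ^≡ hf y) ([1+d]!*α≡d!*[[1+d]*α] d α)

HasLead-Δ⁻¹ : ∀ {d α f} → HasLead d (+ suc d * α) (Δ f) → HasLead (suc d) α f
HasLead-Δ⁻¹ {d} {α} hΔf = hasLead λ y → trans (Δ^≡ hΔf y) (sym ([1+d]!*α≡d!*[[1+d]*α] d α))

-- Leibniz rule Δ(f g) = Δf · g(· + 1) + f · Δg; thanks to the d! in HasLead the
-- leading coefficients of the two summands add up to (d + e + 2) α β.
HasLead-* : ∀ {d e α β f g} → HasLead d α f → HasLead e β g →
            HasLead (d ℕ.+ e) (α * β) (λ y → f y * g y)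
HasLead-* {zero} {e} {α} {β} {f} {g} hf hg =
  HasLead-cong (λ y → cong (_* g y) (sym (trans (Δ^≡ hf y) (ℤ.*-identityˡ α)))) (HasLead-scale α hg)
HasLead-* {suc d} {zero} {α} {β} {f} {g} hf hg =
  HasLead-resp (sym (ℕ.+-identityʳ (suc d))) (ℤ.*-comm β α)
    (HasLead-cong (λ y → ℤ.*-comm (g y) (f y)) (HasLead-* {zero} {suc d} hg hf))
HasLead-* {suc d} {suc e} {α} {β} {f} {g} hf hg =
  HasLead-Δ⁻¹ (HasLead-resp refl coeff (HasLead-cong Δ[fg] (HasLead-+ Δf·g∘suc f·Δg)))
  where
  Δf·g∘suc : HasLead (d ℕ.+ suc e) (+ suc d * α * β) (λ y → Δ f y * g (suc y))
  Δf·g∘suc = HasLead-* {d} {suc e} (HasLead-Δ hf) (HasLead-shift hg)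
  f·Δg : HasLead (d ℕ.+ suc e) (α * (+ suc e * β)) (λ y → f y * Δ g y)
  f·Δg = HasLead-resp (sym (ℕ.+-suc d e)) refl (HasLead-* {suc d} {e} hf (HasLead-Δ hg))
  leibniz : ∀ f₁ f₀ g₁ g₀ → (f₁ - f₀) * g₁ + f₀ * (g₁ - g₀) ≡ f₁ * g₁ - f₀ * g₀
  leibniz = solve-∀
  Δ[fg] : ∀ y → Δ f y * g (suc y) + f y * Δ g y ≡ Δ (λ y → f y * g y) y
  Δ[fg] y = leibniz (f (suc y)) (f y) (g (suc y)) (g y)
  weights : ∀ d e α β → (1ℤ + d) * α * β + α * ((1ℤ + e) * β) ≡ (1ℤ + (d + (1ℤ + e))) * (α * β)
  weights = solve-∀
  coeff : + suc d * α * β + α * (+ suc e * β) ≡ + suc (d ℕ.+ suc e) * (α * β)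
  coeff = trans (weights (+ d) (+ e) α β) (cong (λ n → (1ℤ + n) * (α * β)) (sym (ℤ.pos-+ d (suc e))))

HasLead⇒Δ^≡0 : ∀ {d α f b} → HasLead d α f → d < b → ∀ y → Δ^ b f y ≡ 0ℤ
HasLead⇒Δ^≡0 {d} {α} {f} hf d<b y with ℕ.m≤n⇒∃[o]m+o≡n d<b
... | k , refl = begin
  Δ^ (suc d ℕ.+ k) f y               ≡⟨ cong (λ h → h y) (Δ^-compose (suc d) k f) ⟩
  Δ^ k (Δ^ (suc d) f) y              ≡⟨ Δ^-cong k Δ^[suc-d]≡0 y ⟩
  Δ^ k (λ _ → 0ℤ) y                  ≡⟨ Δ^-zero k y ⟩
  0ℤ                                 ∎
  where
  open ≡-Reasoning
  Δ^[suc-d]≡0 : ∀ y → Δ^ (suc d) f y ≡ 0ℤ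
  Δ^[suc-d]≡0 y = trans (Δ^-suc d f y) (trans (cong₂ _-_ (Δ^≡ hf (suc y)) (Δ^≡ hf y)) (ℤ.+-inverseʳ (+ (d !) * α)))

HasLead-raise : ∀ {d α f e} → HasLead d α f → d < e → HasLead e 0ℤ f
HasLead-raise {e = e} hf d<e = hasLead λ y → trans (HasLead⇒Δ^≡0 hf d<e y) (sym (ℤ.*-zeroʳ (+ (e !))))

HasLead-const : ∀ c → HasLead 0 c (λ _ → c)
HasLead-const c = hasLead λ _ → sym (ℤ.*-identityˡ c)

HasLead-id : HasLead 1 1ℤ (λ y → + y)
HasLead-id = hasLead λ y → Δ-id (+ y)
  where
  Δ-id : ∀ Y → (1ℤ + Y) - Y ≡ 1ℤ * 1ℤ
  Δ-id = solve-∀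

HasLead-ff∘ : ∀ {e} (q : ℕ → ℕ) → (∀ c → HasLead e 1ℤ (λ y → + q y - + c)) →
              ∀ m → HasLead (m ℕ.* e) 1ℤ (λ y → ff m (q y))
HasLead-ff∘ q hq zero    = HasLead-const 1ℤ
HasLead-ff∘ {e} q hq (suc m) =
  HasLead-resp (ℕ.+-comm (m ℕ.* e) e) refl (HasLead-* (HasLead-ff∘ q hq m) (hq m))

HasLead-ff∘-difference :
  ∀ {e} (q r : ℕ → ℕ) → (∀ y → r y ≡ q y ℕ.+ y) →
  (∀ c → HasLead e 1ℤ (λ y → + q y - + c)) → (∀ c → HasLead e 1ℤ (λ y → + r y - + c)) →
  ∀ m → HasLead (m ℕ.* e ℕ.+ 1) (+ suc m) (λ y → ff (suc m) (r y) - ff (suc m) (q y))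
HasLead-ff∘-difference q r r≡q+id hq hr zero =
  HasLead-cong (λ y → sym (ff₁-difference y)) HasLead-id
  where
  identity : ∀ Q Y → 1ℤ * ((Q + Y) - 0ℤ) - 1ℤ * (Q - 0ℤ) ≡ Y
  identity = solve-∀
  ff₁-difference : ∀ y → ff 1 (r y) - ff 1 (q y) ≡ + y
  ff₁-difference y rewrite r≡q+id y | ℤ.pos-+ (q y) y = identity (+ q y) (+ y)
HasLead-ff∘-difference {e} q r r≡q+id hq hr (suc m) =
  HasLead-resp refl (coeff (+ m)) (HasLead-cong (λ y → sym (ff-difference-step y))
    (HasLead-+ (HasLead-resp (degree m e) refl (HasLead-* (HasLead-ff∘-difference q r r≡q+id hq hr m) (hr (suc m))))
               (HasLead-* (HasLead-ff∘ q hq (suc m)) HasLead-id)))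
  where
  identity : ∀ A B Q Y c → A * ((Q + Y) - c) - B * (Q - c) ≡ (A - B) * ((Q + Y) - c) + B * Y
  identity = solve-∀
  ff-difference-step : ∀ y → ff (suc (suc m)) (r y) - ff (suc (suc m)) (q y)
    ≡ (ff (suc m) (r y) - ff (suc m) (q y)) * (+ r y - + suc m) + ff (suc m) (q y) * + y
  ff-difference-step y rewrite r≡q+id y | ℤ.pos-+ (q y) y =
    identity (ff (suc m) (q y ℕ.+ y)) (ff (suc m) (q y)) (+ q y) (+ y) (+ suc m)
  coeff : ∀ m → (1ℤ + m) * 1ℤ + 1ℤ * 1ℤ ≡ 1ℤ + (1ℤ + m)
  coeff = solve-∀
  degree : ∀ m e → m ℕ.* e ℕ.+ 1 ℕ.+ e ≡ e ℕ.+ m ℕ.* e ℕ.+ 1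
  degree = ℕ-Solver.solve-∀

-- Binomial coefficients along a polynomial

module BinomialAlong {e} (q : ℕ → ℕ) (hq : ∀ c → HasLead e 1ℤ (λ y → + q y - + c)) where

  Δ^-C∘-vanish : ∀ {m b} → m ℕ.* e < b → ∀ y → Δ^ b (λ y → + (q y C m)) y ≡ 0ℤ
  Δ^-C∘-vanish {m} {b} me<b y = +[m!]*-cancel m (begin
    + (m !) * Δ^ b (λ y → + (q y C m)) y  ≡⟨ Δ^-ff∘ m q b y ⟨
    Δ^ b (λ y → ff m (q y)) y             ≡⟨ HasLead⇒Δ^≡0 (HasLead-ff∘ q hq m) me<b y ⟩
    0ℤ                                    ≡⟨ ℤ.*-zeroʳ (+ (m !)) ⟨
    + (m !) * 0ℤ                          ∎)
    where open ≡-Reasoning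

  Δ^-C∘-top≢0 : ∀ m y → Δ^ (m ℕ.* e) (λ y → + (q y C m)) y ≢ 0ℤ
  Δ^-C∘-top≢0 m y top≡0 = +[n!]≢0 (m ℕ.* e) (begin
    + ((m ℕ.* e) !)                              ≡⟨ ℤ.*-identityʳ _ ⟨
    + ((m ℕ.* e) !) * 1ℤ                         ≡⟨ Δ^≡ (HasLead-ff∘ q hq m) y ⟨
    Δ^ (m ℕ.* e) (λ y → ff m (q y)) y            ≡⟨ Δ^-ff∘ m q (m ℕ.* e) y ⟩
    + (m !) * Δ^ (m ℕ.* e) (λ y → + (q y C m)) y ≡⟨ cong (+ (m !) *_) top≡0 ⟩
    + (m !) * 0ℤ                                 ≡⟨ ℤ.*-zeroʳ (+ (m !)) ⟩
    0ℤ                                           ∎)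
    where open ≡-Reasoning

module BinomialDifference {e} (q r : ℕ → ℕ) (r≡q+id : ∀ y → r y ≡ q y ℕ.+ y)
  (hq : ∀ c → HasLead e 1ℤ (λ y → + q y - + c)) (hr : ∀ c → HasLead e 1ℤ (λ y → + r y - + c)) where

  private
    Δ^-ff-difference : ∀ m b y → Δ^ b (λ y → ff m (r y) - ff m (q y)) y
                       ≡ + (m !) * (Δ^ b (λ y → + (r y C m)) y - Δ^ b (λ y → + (q y C m)) y)
    Δ^-ff-difference m b y = begin
      Δ^ b (λ y → ff m (r y) - ff m (q y)) y                    ≡⟨ Δ^-- b _ _ y ⟩
      Δ^ b (λ y → ff m (r y)) y - Δ^ b (λ y → ff m (q y)) y     ≡⟨ cong₂ _-_ (Δ^-ff∘ m r b y) (Δ^-ff∘ m q b y) ⟩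
      + (m !) * Δ^ b (λ y → + (r y C m)) y - + (m !) * Δ^ b (λ y → + (q y C m)) y
        ≡⟨ x*y-x*z≡x*[y-z] (+ (m !)) _ _ ⟩
      + (m !) * (Δ^ b (λ y → + (r y C m)) y - Δ^ b (λ y → + (q y C m)) y) ∎
      where
      open ≡-Reasoning
      x*y-x*z≡x*[y-z] : ∀ x y z → x * y - x * z ≡ x * (y - z)
      x*y-x*z≡x*[y-z] = solve-∀

  Δ^-C∘-difference-vanish : ∀ {m b} → m ℕ.* e ℕ.+ 1 < b →
    ∀ y → Δ^ b (λ y → + (r y C suc m)) y ≡ Δ^ b (λ y → + (q y C suc m)) y
  Δ^-C∘-difference-vanish {m} {b} lt y = ℤ.i-j≡0⇒i≡j _ _ (+[m!]*-cancel (suc m) (begin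
    + (suc m !) * (Δ^ b (λ y → + (r y C suc m)) y - Δ^ b (λ y → + (q y C suc m)) y)
      ≡⟨ Δ^-ff-difference (suc m) b y ⟨
    Δ^ b (λ y → ff (suc m) (r y) - ff (suc m) (q y)) y
      ≡⟨ HasLead⇒Δ^≡0 (HasLead-ff∘-difference q r r≡q+id hq hr m) lt y ⟩
    0ℤ
      ≡⟨ ℤ.*-zeroʳ (+ (suc m !)) ⟨
    + (suc m !) * 0ℤ ∎))
    where open ≡-Reasoning

  Δ^-C∘-difference-top≢0 : ∀ m y →
    Δ^ (m ℕ.* e ℕ.+ 1) (λ y → + (r y C suc m)) y ≢ Δ^ (m ℕ.* e ℕ.+ 1) (λ y → + (q y C suc m)) y
  Δ^-C∘-difference-top≢0 m y top≡ with +[m!]*-cancel d (begin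
    + (d !) * + suc m                                    ≡⟨ Δ^≡ (HasLead-ff∘-difference q r r≡q+id hq hr m) y ⟨
    Δ^ d (λ y → ff (suc m) (r y) - ff (suc m) (q y)) y    ≡⟨ Δ^-ff-difference (suc m) d y ⟩
    + (suc m !) * (Xr - Xq)                              ≡⟨ cong (λ x → + (suc m !) * (x - Xq)) top≡ ⟩
    + (suc m !) * (Xq - Xq)                              ≡⟨ cong (+ (suc m !) *_) (ℤ.+-inverseʳ Xq) ⟩
    + (suc m !) * 0ℤ                                     ≡⟨ ℤ.*-zeroʳ (+ (suc m !)) ⟩
    0ℤ                                                   ≡⟨ ℤ.*-zeroʳ (+ (d !)) ⟨
    + (d !) * 0ℤ                                         ∎)
    where
    open ≡-Reasoning
    d = m ℕ.* e ℕ.+ 1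
    Xr = Δ^ d (λ y → + (r y C suc m)) y
    Xq = Δ^ d (λ y → + (q y C suc m)) y
  ... | ()

-- The coefficients of P

pattern k₀ = zero
pattern k₁ = suc zero
pattern k₂ = suc k₁
pattern k₃ = suc k₂

q : Fin 4 → ℕ → ℕ
q k₀ y = 0
q k₁ y = y
q k₂ y = y ℕ.* y
q k₃ y = y ℕ.+ y ℕ.* y

P≡x+q : ∀ k x y → P k x y ≡ x ℕ.+ q k y
P≡x+q k₀ x y = sym (ℕ.+-identityʳ x)
P≡x+q k₁ x y = refl
P≡x+q k₂ x y = refl
P≡x+q k₃ x y = ℕ.+-assoc x y (y ℕ.* y)

degP : Fin 4 → ℕ
degP k₀ = 1
degP k₁ = 1
degP k₂ = 2
degP k₃ = 2

HasLead-q₁ : ∀ c → HasLead 1 1ℤ (λ y → + y - + c)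
HasLead-q₁ c = HasLead-+ HasLead-id (HasLead-raise (HasLead-const (- + c)) (s≤s z≤n))

HasLead-q₂ : ∀ c → HasLead 2 1ℤ (λ y → + (y ℕ.* y) - + c)
HasLead-q₂ c = HasLead-cong (λ y → cong (_- + c) (sym (ℤ.pos-* y y)))
  (HasLead-+ (HasLead-* HasLead-id HasLead-id) (HasLead-raise (HasLead-const (- + c)) (s≤s z≤n)))

HasLead-q₃ : ∀ c → HasLead 2 1ℤ (λ y → + (y ℕ.+ y ℕ.* y) - + c)
HasLead-q₃ c = HasLead-cong (λ y → trans (sym (ℤ.+-assoc (+ y) (+ (y ℕ.* y)) (- + c))) (cong (_- + c) (sym (ℤ.pos-+ y (y ℕ.* y)))))
  (HasLead-+ (HasLead-raise HasLead-id (s≤s (s≤s z≤n))) (HasLead-q₂ c))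

open BinomialAlong using (Δ^-C∘-vanish; Δ^-C∘-top≢0)
open BinomialDifference (q k₂) (q k₃) (λ y → ℕ.+-comm y (y ℕ.* y)) HasLead-q₂ HasLead-q₃

Δ^-C∘q-vanish : ∀ k m {b} → m ℕ.* degP k < b → Δ^ b (λ y → + (q k y C m)) 0 ≡ 0ℤ
Δ^-C∘q-vanish k₀ m {suc b} _ = Δ^-const b (+ (0 C m)) 0
Δ^-C∘q-vanish k₁ m lt = Δ^-C∘-vanish (q k₁) HasLead-q₁ {m} lt 0
Δ^-C∘q-vanish k₂ m lt = Δ^-C∘-vanish (q k₂) HasLead-q₂ {m} lt 0
Δ^-C∘q-vanish k₃ m lt = Δ^-C∘-vanish (q k₃) HasLead-q₃ {m} lt 0

coeff : Fin 4 → ℕ → ℕ → ℕ → ℤ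
coeff k l a b = newton (λ x y → P k x y C l) a b

coeff≡Δ^Δ^ : ∀ k l a b → coeff k l a b ≡ Δ^ b (λ y → Δ^ a (λ x → + ((x ℕ.+ q k y) C l)) 0) 0
coeff≡Δ^Δ^ k l a b = trans (newton≡Δ^Δ^ _ a b)
  (Δ^-cong b (λ y → Δ^-cong a (λ x → cong (λ n → + (n C l)) (P≡x+q k x y)) 0) 0)

coeff-split : ∀ k {l} a m b → a ℕ.+ m ≡ l → coeff k l a b ≡ Δ^ b (λ y → + (q k y C m)) 0
coeff-split k a m b refl = trans (coeff≡Δ^Δ^ k (a ℕ.+ m) a b) (Δ^-cong b (λ y → Δ^-C a m (q k y)) 0)

coeff-high : ∀ k {l a} b → l < a → coeff k l a b ≡ 0ℤ
coeff-high k {l} {a} b l<a = trans (coeff≡Δ^Δ^ k l a b)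
  (trans (Δ^-cong b (λ y → Δ^-C-vanish (q k y) l<a) 0) (Δ^-zero b 0))

a+m*d≤[a+m]*d : ∀ a m {d} → 1 ≤ d → a ℕ.+ m ℕ.* d ≤ (a ℕ.+ m) ℕ.* d
a+m*d≤[a+m]*d a m {suc d} _ =
  subst (a ℕ.+ m ℕ.* suc d ≤_) (sym (ℕ.*-distribʳ-+ (suc d) a m)) (ℕ.+-monoˡ-≤ (m ℕ.* suc d) (ℕ.m≤m*n a (suc d)))

degP≥1 : ∀ k → 1 ≤ degP k
degP≥1 k₀ = s≤s z≤n
degP≥1 k₁ = s≤s z≤n
degP≥1 k₂ = s≤s z≤n
degP≥1 k₃ = s≤s z≤n

coeff-vanish : ∀ k l a b → l ℕ.* degP k < a ℕ.+ b → coeff k l a b ≡ 0ℤ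
coeff-vanish k l a b lt with ℕ.≤-<-connex a l
... | inj₂ l<a = coeff-high k b l<a
... | inj₁ a≤l with ℕ.m≤n⇒∃[o]m+o≡n a≤l
...   | m , refl = trans (coeff-split k a m b refl)
        (Δ^-C∘q-vanish k m (ℕ.+-cancelˡ-< a _ _ (ℕ.≤-<-trans (a+m*d≤[a+m]*d a m (degP≥1 k)) lt)))

coeff₂≡coeff₃ : ∀ l a b → l ℕ.* 2 ≤ a ℕ.+ b → coeff k₂ l a b ≡ coeff k₃ l a b
coeff₂≡coeff₃ l a b le with ℕ.≤-<-connex a l
... | inj₂ l<a = trans (coeff-high k₂ b l<a) (sym (coeff-high k₃ b l<a))
... | inj₁ a≤l with ℕ.m≤n⇒∃[o]m+o≡n a≤l
...   | m , refl = trans (coeff-split k₂ a m b refl)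
        (trans (Δ^-C∘q₂≡Δ^-C∘q₃ m (ℕ.+-cancelˡ-≤ a _ _ (ℕ.≤-trans (a+m*d≤[a+m]*d a m (s≤s z≤n)) le)))
               (sym (coeff-split k₃ a m b refl)))
  where
  Δ^-C∘q₂≡Δ^-C∘q₃ : ∀ m → m ℕ.* 2 ≤ b →
    Δ^ b (λ y → + (q k₂ y C m)) 0 ≡ Δ^ b (λ y → + (q k₃ y C m)) 0
  Δ^-C∘q₂≡Δ^-C∘q₃ zero    _  = refl
  Δ^-C∘q₂≡Δ^-C∘q₃ (suc m) le = sym (Δ^-C∘-difference-vanish {m} (subst (λ n → suc n ≤ b) (ℕ.+-comm 1 (m ℕ.* 2)) le) 0)

coeff-diagonal : ∀ k i → coeff k i i 0 ≡ 1ℤ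
coeff-diagonal k i = coeff-split k i 0 0 (ℕ.+-identityʳ i)

coeff₀-column : ∀ l → coeff k₀ (suc l) 0 (suc l) ≡ 0ℤ
coeff₀-column l = trans (coeff-split k₀ 0 (suc l) (suc l) refl) (Δ^-const l (+ (0 C suc l)) 0)

coeff₁-column : ∀ i → coeff k₁ i 0 i ≡ 1ℤ
coeff₁-column i = trans (coeff-split k₁ 0 i i refl)
  (trans (Δ^-cong i (λ y → cong₂ (λ u v → + (u C v)) (sym (ℕ.+-identityʳ y)) (sym (ℕ.+-identityʳ i))) 0) (Δ^-C i 0 0))

coeff₂-top≢0 : ∀ i → coeff k₂ i 0 (i ℕ.* 2) ≢ 0ℤ
coeff₂-top≢0 i eq = Δ^-C∘-top≢0 (q k₂) HasLead-q₂ i 0 (trans (sym (coeff-split k₂ 0 i (i ℕ.* 2) refl)) eq)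

coeff₃≢coeff₂ : ∀ l → coeff k₃ (suc l) 0 (l ℕ.* 2 ℕ.+ 1) ≢ coeff k₂ (suc l) 0 (l ℕ.* 2 ℕ.+ 1)
coeff₃≢coeff₂ l eq = Δ^-C∘-difference-top≢0 l 0
  (trans (sym (coeff-split k₃ 0 (suc l) b refl)) (trans eq (coeff-split k₂ 0 (suc l) b refl)))
  where b = l ℕ.* 2 ℕ.+ 1

-- The spaces 𝒫 i j

-- bvec l a b k reduces to toℚ (coeff k l a b).
toℚ : ℤ → ℚ
toℚ z = z ℚ./ 1

toℚ-injective : ∀ {m n} → toℚ m ≡ toℚ n → m ≡ n
toℚ-injective {m} {n} eq = trans (sym (↥toℚ m)) (trans (cong ↥_ eq) (↥toℚ n))
  where
  ↥toℚ : ∀ z → ↥ toℚ z ≡ z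
  ↥toℚ z = trans (sym (trans (cong (ℤ._*_ (↥ toℚ z)) (ℤ.gcd-zeroʳ z)) (ℤ.*-identityʳ _))) (ℚ.↥-/ z 1)

-- Definitionally the side condition on the terms of a linear combination in InP.
Admissible : ℕ → ℕ → ℚ × ℕ × ℕ × ℕ → Set
Admissible i j (c , l , a , b) = (1 ≤ l) × (l ≤ i) × (j ≤ a ℕ.+ b)

lincomb-++ : ∀ ts us k → lincomb (ts ++ us) k ≡ lincomb ts k ℚ.+ lincomb us k
lincomb-++ []                     us k = sym (ℚ.+-identityˡ (lincomb us k))
lincomb-++ ((c , l , a , b) ∷ ts) us k =
  trans (cong (ℚ._+_ (c ℚ.* bvec l a b k)) (lincomb-++ ts us k)) (sym (ℚ.+-assoc (c ℚ.* bvec l a b k) (lincomb ts k) (lincomb us k)))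

lincomb-scale : ∀ d ts k → lincomb (map (map₁ (d ℚ.*_)) ts) k ≡ d ℚ.* lincomb ts k
lincomb-scale d []                     k = sym (ℚ.*-zeroʳ d)
lincomb-scale d ((c , l , a , b) ∷ ts) k =
  trans (cong₂ ℚ._+_ (ℚ.*-assoc d c (bvec l a b k)) (lincomb-scale d ts k))
        (sym (ℚ.*-distribˡ-+ d (c ℚ.* bvec l a b k) (lincomb ts k)))

InP-+ : ∀ {i j u w} → InP i j u → InP i j w → InP i j (u +V w)
InP-+ (ts , ts-adm , ts≋u) (us , us-adm , us≋w) =
  ts ++ us , All.++⁺ ts-adm us-adm , λ k → trans (lincomb-++ ts us k) (cong₂ ℚ._+_ (ts≋u k) (us≋w k))

InP-• : ∀ {i j u} d → InP i j u → InP i j (d • u)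
InP-• d (ts , ts-adm , ts≋u) = map (map₁ (d ℚ.*_)) ts , All.map⁺ ts-adm , λ k → trans (lincomb-scale d ts k) (cong (d ℚ.*_) (ts≋u k))

InP-cong : ∀ {i j u w} → u ≋ w → InP i j u → InP i j w
InP-cong u≋w (ts , ts-adm , ts≋u) = ts , ts-adm , λ k → trans (ts≋u k) (u≋w k)

InP-bvec : ∀ {i j} l a b → 1 ≤ l → l ≤ i → j ≤ a ℕ.+ b → InP i j (bvec l a b)
InP-bvec l a b 1≤l l≤i j≤a+b =
  (1ℚ , l , a , b) ∷ [] , (1≤l , l≤i , j≤a+b) ∷ [] , λ k → trans (ℚ.+-identityʳ _) (ℚ.*-identityˡ _)

InP-coord≡0 : ∀ {i j} k → (∀ {l a b} → 1 ≤ l → l ≤ i → j ≤ a ℕ.+ b → bvec l a b k ≡ 0ℚ) →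
              ∀ {v} → InP i j v → v k ≡ 0ℚ
InP-coord≡0 {i} {j} k gen≡0 (ts , ts-adm , ts≋v) = trans (sym (ts≋v k)) (go ts ts-adm)
  where
  go : ∀ ts → All (Admissible i j) ts → lincomb ts k ≡ 0ℚ
  go []                     []             = refl
  go ((c , l , a , b) ∷ ts) ((1≤l , l≤i , j≤a+b) ∷ ts-adm) =
    trans (cong₂ ℚ._+_ (trans (cong (c ℚ.*_) (gen≡0 {l} {a} {b} 1≤l l≤i j≤a+b)) (ℚ.*-zeroʳ c)) (go ts ts-adm))
          (ℚ.+-identityʳ 0ℚ)

InP-coord≡ : ∀ {i j} k k′ → (∀ {l a b} → 1 ≤ l → l ≤ i → j ≤ a ℕ.+ b → bvec l a b k ≡ bvec l a b k′) →
             ∀ {v} → InP i j v → v k ≡ v k′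
InP-coord≡ {i} {j} k k′ gen≡ (ts , ts-adm , ts≋v) = trans (sym (ts≋v k)) (trans (go ts ts-adm) (ts≋v k′))
  where
  go : ∀ ts → All (Admissible i j) ts → lincomb ts k ≡ lincomb ts k′
  go []                     []             = refl
  go ((c , l , a , b) ∷ ts) ((1≤l , l≤i , j≤a+b) ∷ ts-adm) =
    cong₂ ℚ._+_ (cong (c ℚ.*_) (gen≡ {l} {a} {b} 1≤l l≤i j≤a+b)) (go ts ts-adm)

span34-decomposition : ∀ v → v k₀ ≡ 0ℚ → v k₁ ≡ 0ℚ → ((v k₂ • v3) +V ((v k₃ ℚ.- v k₂) • v4)) ≋ v
span34-decomposition v v₀≡0 v₁≡0 k₀ =
  trans (solve 2 (λ a b → a :* con 0ℚ :+ b :* con 0ℚ := con 0ℚ) refl (v k₂) (v k₃ ℚ.- v k₂)) (sym v₀≡0)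
span34-decomposition v v₀≡0 v₁≡0 k₁ =
  trans (solve 2 (λ a b → a :* con 0ℚ :+ b :* con 0ℚ := con 0ℚ) refl (v k₂) (v k₃ ℚ.- v k₂)) (sym v₁≡0)
span34-decomposition v v₀≡0 v₁≡0 k₂ = solve 2 (λ a b → a :* con 1ℚ :+ (b :- a) :* con 0ℚ := a) refl (v k₂) (v k₃)
span34-decomposition v v₀≡0 v₁≡0 k₃ = solve 2 (λ a b → a :* con 1ℚ :+ (b :- a) :* con 1ℚ := b) refl (v k₂) (v k₃)

normalise-v3 : ∀ u → u k₀ ≡ 0ℚ → u k₁ ≡ 0ℚ → u k₂ ≡ u k₃ → .{{_ : ℚ.NonZero (u k₂)}} → ((1/ u k₂) • u) ≋ v3
normalise-v3 u u₀≡0 u₁≡0 u₂≡u₃ k₀ = trans (cong (1/ u k₂ ℚ.*_) u₀≡0) (ℚ.*-zeroʳ (1/ u k₂))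
normalise-v3 u u₀≡0 u₁≡0 u₂≡u₃ k₁ = trans (cong (1/ u k₂ ℚ.*_) u₁≡0) (ℚ.*-zeroʳ (1/ u k₂))
normalise-v3 u u₀≡0 u₁≡0 u₂≡u₃ k₂ = ℚ.*-inverseˡ (u k₂)
normalise-v3 u u₀≡0 u₁≡0 u₂≡u₃ k₃ = trans (cong (1/ u k₂ ℚ.*_) (sym u₂≡u₃)) (ℚ.*-inverseˡ (u k₂))

normalise-v4 : ∀ u → u k₀ ≡ 0ℚ → u k₁ ≡ 0ℚ → .{{_ : ℚ.NonZero (u k₃ ℚ.- u k₂)}} →
               ((1/ (u k₃ ℚ.- u k₂)) • (u +V ((ℚ.- u k₂) • v3))) ≋ v4
normalise-v4 u u₀≡0 u₁≡0 k₀ = trans (cong (λ x → 1/ (u k₃ ℚ.- u k₂) ℚ.* (x ℚ.+ (ℚ.- u k₂) ℚ.* 0ℚ)) u₀≡0)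
  (solve 2 (λ t a → t :* (con 0ℚ :+ (:- a) :* con 0ℚ) := con 0ℚ) refl (1/ (u k₃ ℚ.- u k₂)) (u k₂))
normalise-v4 u u₀≡0 u₁≡0 k₁ = trans (cong (λ x → 1/ (u k₃ ℚ.- u k₂) ℚ.* (x ℚ.+ (ℚ.- u k₂) ℚ.* 0ℚ)) u₁≡0)
  (solve 2 (λ t a → t :* (con 0ℚ :+ (:- a) :* con 0ℚ) := con 0ℚ) refl (1/ (u k₃ ℚ.- u k₂)) (u k₂))
normalise-v4 u u₀≡0 u₁≡0 k₂ = solve 2 (λ t a → t :* (a :+ (:- a) :* con 1ℚ) := con 0ℚ) refl (1/ (u k₃ ℚ.- u k₂)) (u k₂)
normalise-v4 u u₀≡0 u₁≡0 k₃ =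
  trans (cong (1/ (u k₃ ℚ.- u k₂) ℚ.*_) (solve 2 (λ a b → b :+ (:- a) :* con 1ℚ := b :- a) refl (u k₂) (u k₃)))
        (ℚ.*-inverseˡ (u k₃ ℚ.- u k₂))

bvec-vanish : ∀ k l a b → l ℕ.* degP k < a ℕ.+ b → bvec l a b k ≡ 0ℚ
bvec-vanish k l a b lt = cong toℚ (coeff-vanish k l a b lt)

≡-from-difference : ∀ {p q} → p ℚ.- q ≡ 0ℚ → p ≡ q
≡-from-difference {p} {q} p-q≡0 = begin
  p                 ≡⟨ solve 2 (λ p q → p := (p :- q) :+ q) refl p q ⟩
  (p ℚ.- q) ℚ.+ q   ≡⟨ cong (ℚ._+ q) p-q≡0 ⟩
  0ℚ ℚ.+ q          ≡⟨ ℚ.+-identityˡ q ⟩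
  q                 ∎
  where open ≡-Reasoning

v3∈P : ∀ {i j} → 1 ≤ i → j ≤ i ℕ.* 2 → InP i j v3
v3∈P {suc i} {j} _ j≤2i =
  InP-cong (normalise-v3 u (bvec-vanish k₀ (suc i) 0 (suc i ℕ.* 2) i<2i) (bvec-vanish k₁ (suc i) 0 (suc i ℕ.* 2) i<2i)
                          (cong toℚ (coeff₂≡coeff₃ (suc i) 0 (suc i ℕ.* 2) ℕ.≤-refl)))
    (InP-• (1/ u k₂) (InP-bvec (suc i) 0 (suc i ℕ.* 2) (s≤s z≤n) ℕ.≤-refl j≤2i))
  where
  u = bvec (suc i) 0 (suc i ℕ.* 2)
  i<2i : suc i ℕ.* 1 < suc i ℕ.* 2
  i<2i = subst (_< suc i ℕ.* 2) (sym (ℕ.*-identityʳ (suc i))) (ℕ.m<m*n (suc i) 2 (s≤s (s≤s z≤n)))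
  u₂≢0 : u k₂ ≢ 0ℚ
  u₂≢0 eq = coeff₂-top≢0 (suc i) (toℚ-injective eq)
  instance
    u₂-nonZero : ℚ.NonZero (u k₂)
    u₂-nonZero = ℚ.≢-nonZero u₂≢0

2l+1≤2[1+l] : ∀ l → l ℕ.* 2 ℕ.+ 1 ≤ suc l ℕ.* 2
2l+1≤2[1+l] l = subst (_≤ suc l ℕ.* 2) (ℕ.+-comm 1 (l ℕ.* 2)) (ℕ.n≤1+n (suc (l ℕ.* 2)))

l+[1+l]≡l*2+1 : ∀ l → l ℕ.+ suc l ≡ l ℕ.* 2 ℕ.+ 1
l+[1+l]≡l*2+1 = ℕ-Solver.solve-∀

v4∈P : ∀ {l j} → 1 ≤ l → j ≤ l ℕ.* 2 ℕ.+ 1 → InP (suc l) j v4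
v4∈P {l} {j} 1≤l j≤2l+1 =
  InP-cong (normalise-v4 u (bvec-vanish k₀ (suc l) 0 b i<b) (bvec-vanish k₁ (suc l) 0 b i<b))
    (InP-• (1/ (u k₃ ℚ.- u k₂))
      (InP-+ (InP-bvec (suc l) 0 b (s≤s z≤n) ℕ.≤-refl j≤2l+1)
             (InP-• (ℚ.- u k₂) (v3∈P (s≤s z≤n) (ℕ.≤-trans j≤2l+1 (2l+1≤2[1+l] l))))))
  where
  b = l ℕ.* 2 ℕ.+ 1
  u = bvec (suc l) 0 b
  i<b : suc l ℕ.* 1 < b
  i<b = begin-strict
    suc l ℕ.* 1   ≡⟨ ℕ.*-identityʳ (suc l) ⟩
    suc l         <⟨ ℕ.+-monoˡ-≤ (suc l) 1≤l ⟩
    l ℕ.+ suc l   ≡⟨ l+[1+l]≡l*2+1 l ⟩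
    b             ∎
    where open ℕ.≤-Reasoning
  u₃-u₂≢0 : u k₃ ℚ.- u k₂ ≢ 0ℚ
  u₃-u₂≢0 eq = coeff₃≢coeff₂ l (toℚ-injective (≡-from-difference eq))
  instance
    u₃-u₂-nonZero : ℚ.NonZero (u k₃ ℚ.- u k₂)
    u₃-u₂-nonZero = ℚ.≢-nonZero u₃-u₂≢0

Span34⊆P : ∀ {l j} → 1 ≤ l → j ≤ l ℕ.* 2 ℕ.+ 1 → ∀ {v} → InSpan34 v → InP (suc l) j v
Span34⊆P {l} 1≤l j≤2l+1 (c , d , c•v3+d•v4≋v) =
  InP-cong c•v3+d•v4≋v (InP-+ (InP-• c (v3∈P (s≤s z≤n) (ℕ.≤-trans j≤2l+1 (2l+1≤2[1+l] l)))) (InP-• d (v4∈P 1≤l j≤2l+1)))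

P-full : ∀ {l j} → 1 ≤ l → j ≤ suc l → ∀ v → InP (suc l) j v
P-full {l} {j} 1≤l j≤i v = InP-cong v≋s+r (InP-+ s∈P r∈P)
  where
  i = suc l
  u = bvec i i 0
  w = bvec i 0 i
  s = (v k₀ • u) +V ((v k₁ ℚ.- v k₀) • w)
  r : V4
  r k = v k ℚ.- s k
  s∈P : InP i j s
  s∈P = InP-+ (InP-• (v k₀) (InP-bvec i i 0 (s≤s z≤n) ℕ.≤-refl (subst (j ≤_) (sym (ℕ.+-identityʳ i)) j≤i)))
              (InP-• (v k₁ ℚ.- v k₀) (InP-bvec i 0 i (s≤s z≤n) ℕ.≤-refl j≤i))
  r₀≡0 : r k₀ ≡ 0ℚ
  r₀≡0 = trans (cong₂ (λ p q → v k₀ ℚ.- (v k₀ ℚ.* p ℚ.+ (v k₁ ℚ.- v k₀) ℚ.* q))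
                       (cong toℚ (coeff-diagonal k₀ i)) (cong toℚ (coeff₀-column l)))
               (solve 2 (λ a b → a :- (a :* con 1ℚ :+ (b :- a) :* con 0ℚ) := con 0ℚ) refl (v k₀) (v k₁))
  r₁≡0 : r k₁ ≡ 0ℚ
  r₁≡0 = trans (cong₂ (λ p q → v k₁ ℚ.- (v k₀ ℚ.* p ℚ.+ (v k₁ ℚ.- v k₀) ℚ.* q))
                       (cong toℚ (coeff-diagonal k₁ i)) (cong toℚ (coeff₁-column i)))
               (solve 2 (λ a b → b :- (a :* con 1ℚ :+ (b :- a) :* con 1ℚ) := con 0ℚ) refl (v k₀) (v k₁))
  r∈P : InP i j r
  r∈P = Span34⊆P 1≤l (ℕ.≤-trans j≤i (ℕ.≤-trans (ℕ.m≤n+m i l) (ℕ.≤-reflexive (l+[1+l]≡l*2+1 l))))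
          (r k₂ , r k₃ ℚ.- r k₂ , span34-decomposition r r₀≡0 r₁≡0)
  v≋s+r : (s +V r) ≋ v
  v≋s+r k = solve 2 (λ a b → b :+ (a :- b) := a) refl (v k) (s k)

InP-coord-vanish : ∀ {i j v} k → i ℕ.* degP k < j → InP i j v → v k ≡ 0ℚ
InP-coord-vanish {i} k i*d<j = InP-coord≡0 k λ {l} {a} {b} _ l≤i j≤a+b →
  bvec-vanish k l a b (ℕ.≤-<-trans (ℕ.*-monoˡ-≤ (degP k) l≤i) (ℕ.<-≤-trans i*d<j j≤a+b))

P⊆Span34 : ∀ {i j v} → i < j → InP i j v → InSpan34 v
P⊆Span34 {i} {j} {v} i<j v∈P =
  v k₂ , v k₃ ℚ.- v k₂ , span34-decomposition v (InP-coord-vanish k₀ i*1<j v∈P) (InP-coord-vanish k₁ i*1<j v∈P)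
  where
  i*1<j : i ℕ.* 1 < j
  i*1<j = subst (_< j) (sym (ℕ.*-identityʳ i)) i<j

P⊆Span3 : ∀ {i j v} → 1 ≤ i → i ℕ.* 2 ≤ j → InP i j v → InSpan3 v
P⊆Span3 {i} {j} {v} 1≤i 2i≤j v∈P = v k₂ , v₂•v3≋v
  where
  i*1<j : i ℕ.* 1 < j
  i*1<j = ℕ.<-≤-trans (subst (_< i ℕ.* 2) (sym (ℕ.*-identityʳ i)) (ℕ.m<m*n i 2 {{ℕ.>-nonZero 1≤i}} (s≤s (s≤s z≤n)))) 2i≤j
  v₂≡v₃ : v k₂ ≡ v k₃
  v₂≡v₃ = InP-coord≡ k₂ k₃ (λ {l} {a} {b} _ l≤i j≤a+b →
    cong toℚ (coeff₂≡coeff₃ l a b (ℕ.≤-trans (ℕ.*-monoˡ-≤ 2 l≤i) (ℕ.≤-trans 2i≤j j≤a+b)))) v∈P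
  v₂•v3≋v : (v k₂ • v3) ≋ v
  v₂•v3≋v k₀ = trans (ℚ.*-zeroʳ (v k₂)) (sym (InP-coord-vanish k₀ i*1<j v∈P))
  v₂•v3≋v k₁ = trans (ℚ.*-zeroʳ (v k₂)) (sym (InP-coord-vanish k₁ i*1<j v∈P))
  v₂•v3≋v k₂ = ℚ.*-identityʳ (v k₂)
  v₂•v3≋v k₃ = trans (ℚ.*-identityʳ (v k₂)) v₂≡v₃

P⊆0 : ∀ {i j v} → i ℕ.* 2 < j → InP i j v → v ≋ zeroV
P⊆0 {i} 2i<j v∈P k = InP-coord-vanish k (ℕ.≤-<-trans (ℕ.*-monoʳ-≤ i (degP≤2 k)) 2i<j) v∈P
  where
  degP≤2 : ∀ k → degP k ≤ 2
  degP≤2 k₀ = s≤s z≤n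
  degP≤2 k₁ = s≤s z≤n
  degP≤2 k₂ = ℕ.≤-refl
  degP≤2 k₃ = ℕ.≤-refl

lemma4p2 : (i : ℕ) → 1 < i →
    (∀ j → 1 ≤ j → j ≤ i → ∀ v → InP i j v)
    × (∀ j → i ℕ.+ 1 ≤ j → j ≤ 2 ℕ.* i ∸ 1 → ∀ v → InP i j v ⇔ InSpan34 v)
    × (∀ v → InP i (2 ℕ.* i) v ⇔ InSpan3 v)
    × (∀ j → 2 ℕ.* i < j → ∀ v → InP i j v ⇔ (v ≋ zeroV))
lemma4p2 i@(suc l) (s≤s 1≤l) =
  (λ j _ j≤i → P-full 1≤l j≤i) ,
  (λ j i+1≤j j≤2i∸1 v → mk⇔ (P⊆Span34 (subst (_≤ j) (ℕ.+-comm i 1) i+1≤j))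
                             (Span34⊆P 1≤l (subst (j ≤_) (2[1+l]∸1≡l*2+1 l) j≤2i∸1))) ,
  (λ v → mk⇔ (P⊆Span3 {i} (s≤s z≤n) (ℕ.≤-reflexive (sym 2i≡i*2)))
             (λ (c , c•v3≋v) → InP-cong c•v3≋v (InP-• c (v3∈P {i} (s≤s z≤n) (ℕ.≤-reflexive 2i≡i*2))))) ,
  (λ j 2i<j v → mk⇔ (P⊆0 (subst (_< j) 2i≡i*2 2i<j)) (λ v≋0 → [] , [] , λ k → sym (v≋0 k)))
  where
  2i≡i*2 : 2 ℕ.* i ≡ i ℕ.* 2
  2i≡i*2 = ℕ.*-comm 2 i
  2[1+l]∸1≡l*2+1 : ∀ l → 2 ℕ.* suc l ∸ 1 ≡ l ℕ.* 2 ℕ.+ 1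
  2[1+l]∸1≡l*2+1 l = l+1*[1+l]≡l*2+1 l
    where
    l+1*[1+l]≡l*2+1 : ∀ l → l ℕ.+ 1 ℕ.* suc l ≡ l ℕ.* 2 ℕ.+ 1
    l+1*[1+l]≡l*2+1 = ℕ-Solver.solve-∀
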